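{- Let $L$ be a dcpo-$\vee_{\uparrow}$-semilattice. If $A \subseteq L$ is $F$-Scott closed and $F$-$\bigvee$-existing, then $A = \downarrow a$ for some $a \in L$.
   Context: A subset of a poset is consistent if it has an upper bound. A dcpo-$\vee_{\uparrow}$-semilattice is a dcpo in which every consistent pair of elements has a join. A dcpo-$\vee_{\uparrow}$-semilattice homomorphism is a Scott continuous map preserving joins of consistent pairs. A subset $A$ of $L$ is $F$-Scott closed if it is a lower set closed under directed suprema and $\bigvee F \in A$ for every nonempty finite consistent $F \subseteq A$. A subset $A \subseteq L$ is $F$-$\bigvee$-existing if for every dcpo-$\vee_{\uparrow}$-semilattice homomorphism $f : L \to M$ into any dcpo-$\vee_{\uparrow}$-semilattice $M$, $\bigvee f(A)$ exists in $M$. $\downarrow a = \{x \in L : x \le a\}$. -}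

module Defs where

open import Level using (Level; _⊔_; suc)
open import Agda.Primitive using (Setω)
open import Data.Product using (Σ; ∃; _×_; _,_)
open import Data.List using (List; []; _∷_)
open import Data.List.Relation.Unary.All using (All)
open import Relation.Unary using (Pred; _∈_)
open import Relation.Binary.Bundles using (Poset)

module PosetNotions {c ℓ₁ ℓ₂ : Level} (P : Poset c ℓ₁ ℓ₂) where
  open Poset P

  Subset : Set (suc (c ⊔ ℓ₁ ⊔ ℓ₂))
  Subset = Pred Carrier (c ⊔ ℓ₁ ⊔ ℓ₂)

  IsUpper : Subset → Carrier → Set (c ⊔ ℓ₁ ⊔ ℓ₂)
  IsUpper S u = ∀ x → x ∈ S → x ≤ u

  IsSup : Subset → Carrier → Set (c ⊔ ℓ₁ ⊔ ℓ₂)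
  IsSup S u = IsUpper S u × (∀ v → IsUpper S v → u ≤ v)

  Directed : Subset → Set (c ⊔ ℓ₁ ⊔ ℓ₂)
  Directed S = (∃ λ x → x ∈ S)
             × (∀ x y → x ∈ S → y ∈ S → ∃ λ z → z ∈ S × x ≤ z × y ≤ z)

  ConsistentPair : Carrier → Carrier → Set (c ⊔ ℓ₂)
  ConsistentPair x y = ∃ λ u → x ≤ u × y ≤ u

  IsJoin : Carrier → Carrier → Carrier → Set (c ⊔ ℓ₂)
  IsJoin x y j = x ≤ j × y ≤ j × (∀ u → x ≤ u → y ≤ u → j ≤ u)

  -- finite subsets given as lists
  IsUpperL : List Carrier → Carrier → Set (c ⊔ ℓ₂)
  IsUpperL xs u = All (λ x → x ≤ u) xs

  ConsistentL : List Carrier → Set (c ⊔ ℓ₂)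
  ConsistentL xs = ∃ λ u → IsUpperL xs u

  IsSupL : List Carrier → Carrier → Set (c ⊔ ℓ₂)
  IsSupL xs u = IsUpperL xs u × (∀ v → IsUpperL xs v → u ≤ v)

  IsLower : Subset → Set (c ⊔ ℓ₁ ⊔ ℓ₂)
  IsLower A = ∀ x y → x ≤ y → y ∈ A → x ∈ A

  DirClosed : Subset → Set (suc (c ⊔ ℓ₁ ⊔ ℓ₂))
  DirClosed A = ∀ (D : Subset) → Directed D → (∀ x → x ∈ D → x ∈ A)
              → ∀ d → IsSup D d → d ∈ A

  FScottClosed : Subset → Set (suc (c ⊔ ℓ₁ ⊔ ℓ₂))
  FScottClosed A = IsLower A × DirClosed A
    × (∀ (x : Carrier) (xs : List Carrier) → All (λ y → y ∈ A) (x ∷ xs)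
         → ConsistentL (x ∷ xs) → ∀ j → IsSupL (x ∷ xs) j → j ∈ A)

  ↓ : Carrier → Pred Carrier ℓ₂
  ↓ a = λ x → x ≤ a

record DcpoSL (c ℓ₁ ℓ₂ : Level) : Set (suc (c ⊔ ℓ₁ ⊔ ℓ₂)) where
  field
    poset : Poset c ℓ₁ ℓ₂
  open Poset poset public
  open PosetNotions poset public
  field
    dirSup   : ∀ (D : Subset) → Directed D → ∃ λ d → IsSup D d
    pairJoin : ∀ x y → ConsistentPair x y → ∃ λ j → IsJoin x y j

module _ {c ℓ₁ ℓ₂ c' ℓ₁' ℓ₂' : Level} (L : DcpoSL c ℓ₁ ℓ₂) (M : DcpoSL c' ℓ₁' ℓ₂') where
  private
    module L = DcpoSL L
    module M = DcpoSL M

  IsSupImage : (L.Carrier → M.Carrier) → L.Subset → M.Carrier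
             → Set (c ⊔ ℓ₁ ⊔ ℓ₂ ⊔ c' ⊔ ℓ₂')
  IsSupImage f S m = (∀ x → x ∈ S → f x M.≤ m)
                   × (∀ v → (∀ x → x ∈ S → f x M.≤ v) → m M.≤ v)

  ScottContinuous : (L.Carrier → M.Carrier) → Set (suc (c ⊔ ℓ₁ ⊔ ℓ₂) ⊔ c' ⊔ ℓ₂')
  ScottContinuous f = ∀ (D : L.Subset) → L.Directed D
                    → ∀ d → L.IsSup D d → IsSupImage f D (f d)

  IsHom : (L.Carrier → M.Carrier) → Set (suc (c ⊔ ℓ₁ ⊔ ℓ₂) ⊔ c' ⊔ ℓ₂')
  IsHom f = ScottContinuous f
          × (∀ x y → L.ConsistentPair x y → ∀ j → L.IsJoin x y j
               → M.IsJoin (f x) (f y) (f j))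

FJoinExisting : ∀ {c ℓ₁ ℓ₂} (L : DcpoSL c ℓ₁ ℓ₂) → DcpoSL.Subset L → Setω
FJoinExisting L A = ∀ {c' ℓ₁' ℓ₂'} (M : DcpoSL c' ℓ₁' ℓ₂')
  (f : DcpoSL.Carrier L → DcpoSL.Carrier M) → IsHom L M f
  → ∃ λ m → IsSupImage L M f A m

-- By the identity homomorphism, ⋁A exists in L itself; call it a, so A ⊆ ↓a.
-- A is inhabited: send L constantly to true in the two-point order on Bool
-- that collapses to a single point exactly when A is inhabited.  The supremum
-- m of the image lies below both true and false (false bounds the image once A
-- has an element), which in that order forces the collapse.
-- Being inhabited and bounded by a, A is directed, because the join of two of
-- its elements exists and lies in A; hence a ∈ A and, A being a lower set,
-- ↓a ⊆ A.
module Submission where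

open import Defs
open import Level using (Level; 0ℓ)
open import Function using (id)
open import Data.Product using (∃; _×_; _,_)
open import Data.Sum using (_⊎_; inj₁; inj₂)
open import Data.Bool using (Bool; true; false)
open import Data.List using ([]; _∷_)
open import Data.List.Relation.Unary.All using ([]; _∷_)
open import Relation.Unary using (_∈_)
open import Relation.Binary.PropositionalEquality as ≡ using (_≡_; refl)
open import Relation.Binary.Bundles using (Poset)
open import Relation.Binary.Structures using (IsEquivalence)

module BoolCollapsedBy {p : Level} (P : Set p) where

  infix 4 _≋_
  _≋_ : Bool → Bool → Set p
  x ≋ y = x ≡ y ⊎ P

  ≋-refl : ∀ {x} → x ≋ x
  ≋-refl = inj₁ refl

  ≋-sym : ∀ {x y} → x ≋ y → y ≋ x
  ≋-sym (inj₁ x≡y) = inj₁ (≡.sym x≡y)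
  ≋-sym (inj₂ q)   = inj₂ q

  ≋-trans : ∀ {x y z} → x ≋ y → y ≋ z → x ≋ z
  ≋-trans (inj₁ x≡y) (inj₁ y≡z) = inj₁ (≡.trans x≡y y≡z)
  ≋-trans (inj₂ q)   _          = inj₂ q
  ≋-trans _          (inj₂ q)   = inj₂ q

  ≋-isEquivalence : IsEquivalence _≋_
  ≋-isEquivalence = record { refl = ≋-refl ; sym = ≋-sym ; trans = ≋-trans }

  true≋false⇒P : true ≋ false → P
  true≋false⇒P (inj₁ ())
  true≋false⇒P (inj₂ q) = q

  -- The order coincides with the equality, so every directed set is bounded
  -- by any of its elements and every consistent pair is joined by its first.
  poset : Poset 0ℓ p p
  poset = record
    { Carrier        = Bool
    ; _≈_            = _≋_
    ; _≤_            = _≋_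
    ; isPartialOrder = record
      { isPreorder = record
        { isEquivalence = ≋-isEquivalence
        ; reflexive     = id
        ; trans         = ≋-trans
        }
      ; antisym    = λ x≋y _ → x≋y
      }
    }

  open PosetNotions poset

  directed-sup : ∀ D → Directed D → ∃ λ d → IsSup D d
  directed-sup D ((d , d∈D) , dir) = d , upper , λ v v-upper → v-upper d d∈D
    where
    upper : IsUpper D d
    upper x x∈D with dir x d x∈D d∈D
    ... | _ , _ , x≋z , d≋z = ≋-trans x≋z (≋-sym d≋z)

  pair-join : ∀ x y → ConsistentPair x y → ∃ λ j → IsJoin x y j
  pair-join x y (_ , x≋u , y≋u) = x , ≋-refl , ≋-trans y≋u (≋-sym x≋u) , λ _ x≋v _ → x≋v

  dcpoSL : DcpoSL 0ℓ p p
  dcpoSL = record { poset = poset ; dirSup = directed-sup ; pairJoin = pair-join }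

module _ {c ℓ₁ ℓ₂ : Level} (L : DcpoSL c ℓ₁ ℓ₂) where
  open DcpoSL L

  id-isHom : IsHom L L id
  id-isHom = (λ _ _ _ isSup → isSup) , λ _ _ _ _ isJoin → isJoin

  const-isHom : ∀ {c′ ℓ₁′ ℓ₂′} (M : DcpoSL c′ ℓ₁′ ℓ₂′) (b : DcpoSL.Carrier M) → IsHom L M (λ _ → b)
  const-isHom M b = (λ { _ ((x , x∈D) , _) _ _ → (λ _ _ → M.refl) , λ v v-upper → v-upper x x∈D })
                  , λ _ _ _ _ _ → M.refl , M.refl , λ u b≤u _ → b≤u
    where module M = DcpoSL M

  FJoinExisting⇒inhabited : ∀ A → FJoinExisting L A → ∃ λ x → x ∈ A
  FJoinExisting⇒inhabited A A-FJ = collapse (A-FJ dcpoSL (λ _ → true) (const-isHom dcpoSL true))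
    where
    open BoolCollapsedBy (∃ λ x → x ∈ A)
    collapse : (∃ λ m → IsSupImage L dcpoSL (λ _ → true) A m) → ∃ λ x → x ∈ A
    collapse (m , _ , m-least) = true≋false⇒P (≋-trans (≋-sym m≋true) m≋false)
      where
      m≋true : m ≋ true
      m≋true = m-least true λ _ _ → ≋-refl
      m≋false : m ≋ false
      m≋false = m-least false λ x x∈A → inj₂ (x , x∈A)

  IsJoin⇒IsSupL : ∀ {x y j} → IsJoin x y j → IsSupL (x ∷ y ∷ []) j
  IsJoin⇒IsSupL (x≤j , y≤j , least) = (x≤j ∷ y≤j ∷ []) , λ { v (x≤v ∷ y≤v ∷ []) → least v x≤v y≤v }

  inhabited-bounded-FScottClosed⇒directed :
    ∀ A a → FScottClosed A → IsUpper A a → (∃ λ x → x ∈ A) → Directed A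
  inhabited-bounded-FScottClosed⇒directed A a (_ , _ , join-closed) a-upper inhabited =
    inhabited , λ x y x∈A y∈A → join-in-A x y x∈A y∈A
    where
    join-in-A : ∀ x y → x ∈ A → y ∈ A → ∃ λ z → z ∈ A × x ≤ z × y ≤ z
    join-in-A x y x∈A y∈A with pairJoin x y (a , a-upper x x∈A , a-upper y y∈A)
    ... | j , isJoin@(x≤j , y≤j , _) =
      j , join-closed x (y ∷ []) (x∈A ∷ y∈A ∷ []) (a , a-upper x x∈A ∷ a-upper y y∈A ∷ [])
            j (IsJoin⇒IsSupL isJoin)
        , x≤j , y≤j

lemma3p7 : ∀ {c ℓ₁ ℓ₂ : Level} (L : DcpoSL c ℓ₁ ℓ₂) (A : DcpoSL.Subset L)
    → DcpoSL.FScottClosed L A → FJoinExisting L A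
    → ∃ λ a → ∀ x → (x ∈ A → x ∈ DcpoSL.↓ L a) × (x ∈ DcpoSL.↓ L a → x ∈ A)
lemma3p7 L A A-closed@(lower , dir-closed , _) A-FJ with A-FJ L id (id-isHom L)
... | a , a-upper , a-least = a , λ x → a-upper x , λ x≤a → lower x a x≤a a∈A
  where
  A-directed : DcpoSL.Directed L A
  A-directed = inhabited-bounded-FScottClosed⇒directed L A a A-closed a-upper
                 (FJoinExisting⇒inhabited L A A-FJ)
  a∈A : a ∈ A
  a∈A = dir-closed A A-directed (λ _ x∈A → x∈A) a (a-upper , a-least)
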